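{- There exist an integer $k\ge 2$, an integer $n\ge 1$, and an $\mathrm{SL}_k$-frieze pattern of height $n$ over $\mathbb{Q}$ which is periodic and wild and all of whose entries $c_{i,j}$ ($i\in\mathbb{Z}$, $1\le j\le n$) are positive integers.
   Context: Let $k\ge 2$ and $n\ge 1$ be integers and $K$ a field. An $\mathrm{SL}_k$-frieze pattern of height $n$ over $K$ is a family $(a_{i,j})$ of elements of $K$, indexed by $i\in\mathbb{Z}$ and $i-k\le j\le i+n+k-1$, such that $a_{i,j}=0$ for $i-k\le j\le i-2$ and for $i+n+1\le j\le i+n+k-1$, $a_{i,i-1}=a_{i,i+n}=1$, and (writing $c_{i,j}:=a_{i,i+j-1}$ for $1\le j\le n$, the "entries" of the pattern, which are otherwise arbitrary) for every $i\in\mathbb{Z}$ and every $j$ with $i-1\le j\le i+n$ the $k\times k$ matrix $(a_{r,s})_{i\le r\le i+k-1,\ j\le s\le j+k-1}$ has determinant $1$. The pattern is periodic if there is $m>0$ with $c_{i,j}=c_{i+m,j}$ for all $i\in\mathbb{Z}$, $1\le j\le n$. It is tame if for every $i\in\mathbb{Z}$ and every $j$ with $i\le j\le i+n-1$ the $(k+1)\times(k+1)$ matrix $(a_{r,s})_{i\le r\le i+k,\ j\le s\le j+k}$ has determinant $0$; it is wild if it is not tame. -}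

module Defs where

open import Data.Nat as ℕ using (ℕ; zero; suc)
open import Data.Fin using (Fin; zero; suc; toℕ; punchIn)
open import Data.Integer as ℤ using (ℤ; +_; _-_)
open import Data.Rational using (ℚ; 0ℚ; 1ℚ; -_; _/_)
import Data.Rational as Q
open import Data.Product using (Σ; _×_; ∃)
open import Relation.Binary.PropositionalEquality using (_≡_)
open import Relation.Nullary using (¬_)

sumFin : (n : ℕ) → (Fin n → ℚ) → ℚ
sumFin zero    f = 0ℚ
sumFin (suc n) f = f zero Q.+ sumFin n (λ j → f (suc j))

sign : ℕ → ℚ
sign zero    = 1ℚ
sign (suc m) = - sign m

det : (m : ℕ) → (Fin m → Fin m → ℚ) → ℚ
det zero    M = 1ℚ
det (suc m) M =
  sumFin (suc m) (λ j → (sign (toℕ j) Q.* M zero j) Q.* det m (λ r c → M (suc r) (punchIn j c)))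

block : (m : ℕ) → (ℤ → ℤ → ℚ) → ℤ → ℤ → Fin m → Fin m → ℚ
block m a i j r s = a (i ℤ.+ + toℕ r) (j ℤ.+ + toℕ s)

-- The family (a_{i,j}) is modelled by a total function ℤ → ℤ → ℚ; only the
-- values with i-k ≤ j ≤ i+n+k-1 are constrained/used (all conditions below only
-- refer to such indices), so values outside this range are irrelevant.
record IsSLFrieze (k n : ℕ) (a : ℤ → ℤ → ℚ) : Set where
  field
    zerosLeft  : ∀ i j → i - + k ℤ.≤ j → j ℤ.≤ i - + 2 → a i j ≡ 0ℚ
    zerosRight : ∀ i j → i ℤ.+ + n ℤ.+ + 1 ℤ.≤ j → j ℤ.≤ i ℤ.+ + n ℤ.+ + k - + 1 → a i j ≡ 0ℚ
    oneLeft    : ∀ i → a i (i - + 1) ≡ 1ℚ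
    oneRight   : ∀ i → a i (i ℤ.+ + n) ≡ 1ℚ
    detOne     : ∀ i j → i - + 1 ℤ.≤ j → j ℤ.≤ i ℤ.+ + n → det k (block k a i j) ≡ 1ℚ

entry : (ℤ → ℤ → ℚ) → ℤ → ℤ → ℚ
entry a i j = a i (i ℤ.+ j - + 1)

IsPeriodic : (n : ℕ) → (ℤ → ℤ → ℚ) → Set
IsPeriodic n a = Σ ℕ λ m → (0 ℕ.< m) ×
  (∀ i j → + 1 ℤ.≤ j → j ℤ.≤ + n → entry a i j ≡ entry a (i ℤ.+ + m) j)

IsTame : (k n : ℕ) → (ℤ → ℤ → ℚ) → Set
IsTame k n a = ∀ i j → i ℤ.≤ j → j ℤ.≤ i ℤ.+ + n - + 1 → det (suc k) (block (suc k) a i j) ≡ 0ℚ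

IsWild : (k n : ℕ) → (ℤ → ℤ → ℚ) → Set
IsWild k n a = ¬ IsTame k n a

EntriesPositiveIntegers : (n : ℕ) → (ℤ → ℤ → ℚ) → Set
EntriesPositiveIntegers n a =
  ∀ i j → + 1 ℤ.≤ j → j ℤ.≤ + n → Σ ℕ λ p → (0 ℕ.< p) × (entry a i j ≡ (+ p) / 1)

-- Take k = 4, n = 2 and a_{i,j} = 1 for i-1 ≤ j ≤ i+2, 0 otherwise, so that every
-- entry is 1. The pattern is invariant under (i , j) ↦ (i+1 , j+1), so each block
-- is a Toeplitz band matrix depending only on j - i, and the frieze conditions
-- reduce to finitely many determinants: the 4×4 ones on the diagonals -1 … 2 are 1,
-- and the 5×5 one on the main diagonal is 1 as well, which breaks tameness.

module Submission where

open import Defs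
open import Data.Nat using (ℕ; _≤_)
open import Data.Integer using (ℤ)
open import Data.Rational using (ℚ)
open import Data.Product using (Σ; _×_)

import Data.Nat as ℕ
open import Data.Fin using (Fin; zero; suc; toℕ; punchIn)
open import Data.Integer as ℤ using (+_; -[1+_]; _-_; +≤+; -≤-)
import Data.Integer.Properties as ℤₚ
open import Data.Integer.Tactic.RingSolver using (solve-∀)
open import Data.Rational using (0ℚ; 1ℚ; _/_)
import Data.Rational as ℚ
open import Data.Product using (_,_)
open import Relation.Binary.PropositionalEquality

sumFin-cong : ∀ n {g h : Fin n → ℚ} → (∀ x → g x ≡ h x) → sumFin n g ≡ sumFin n h
sumFin-cong ℕ.zero    g≗h = refl
sumFin-cong (ℕ.suc n) g≗h = cong₂ ℚ._+_ (g≗h zero) (sumFin-cong n (λ x → g≗h (suc x)))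

det-cong : ∀ m {M K : Fin m → Fin m → ℚ} → (∀ r s → M r s ≡ K r s) → det m M ≡ det m K
det-cong ℕ.zero    M≗K = refl
det-cong (ℕ.suc m) M≗K = sumFin-cong (ℕ.suc m) λ j →
  cong₂ (λ x y → (sign (toℕ j) ℚ.* x) ℚ.* y) (M≗K zero j)
        (det-cong m (λ r c → M≗K (suc r) (punchIn j c)))

toeplitz : (ℤ → ℚ) → ℤ → ℤ → ℚ
toeplitz f i j = f (j - i)

toeplitzMatrix : (m : ℕ) → (ℤ → ℚ) → ℤ → Fin m → Fin m → ℚ
toeplitzMatrix m f d r s = f (d ℤ.+ + toℕ s - + toℕ r)

det-block-toeplitz : ∀ m f i j →
  det m (block m (toeplitz f) i j) ≡ det m (toeplitzMatrix m f (j - i))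
det-block-toeplitz m f i j = det-cong m λ r s → cong f (shift i j (+ toℕ r) (+ toℕ s))
  where
  shift : ∀ i j r s → (j ℤ.+ s) - (i ℤ.+ r) ≡ (j - i) ℤ.+ s - r
  shift = solve-∀

entry-toeplitz : ∀ f i j → entry (toeplitz f) i j ≡ f (j - + 1)
entry-toeplitz f i j = cong f (cancel i j)
  where
  cancel : ∀ i j → (i ℤ.+ j - + 1) - i ≡ j - + 1
  cancel = solve-∀

≤-diagonalˡ : ∀ i x {j} → i ℤ.+ x ℤ.≤ j → x ℤ.≤ j - i
≤-diagonalˡ i x {j} i+x≤j = subst (ℤ._≤ j - i) (cancel i x) (ℤₚ.+-monoˡ-≤ (ℤ.- i) i+x≤j)
  where
  cancel : ∀ i x → (i ℤ.+ x) - i ≡ x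
  cancel = solve-∀

≤-diagonalʳ : ∀ i x {j} → j ℤ.≤ i ℤ.+ x → j - i ℤ.≤ x
≤-diagonalʳ i x {j} j≤i+x = subst (j - i ℤ.≤_) (cancel i x) (ℤₚ.+-monoˡ-≤ (ℤ.- i) j≤i+x)
  where
  cancel : ∀ i x → (i ℤ.+ x) - i ≡ x
  cancel = solve-∀

toeplitz-isSLFrieze : ∀ k n f →
  (∀ d → ℤ.- + k ℤ.≤ d → d ℤ.≤ ℤ.- + 2 → f d ≡ 0ℚ) →
  (∀ d → + n ℤ.+ + 1 ℤ.≤ d → d ℤ.≤ + n ℤ.+ + k - + 1 → f d ≡ 0ℚ) →
  f (ℤ.- + 1) ≡ 1ℚ → f (+ n) ≡ 1ℚ →
  (∀ d → ℤ.- + 1 ℤ.≤ d → d ℤ.≤ + n → det k (toeplitzMatrix k f d) ≡ 1ℚ) →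
  IsSLFrieze k n (toeplitz f)
toeplitz-isSLFrieze k n f zeroBelow zeroAbove fOneBelow fOneAbove detMinors = record
  { zerosLeft  = λ i j lo hi → zeroBelow (j - i) (≤-diagonalˡ i _ lo) (≤-diagonalʳ i _ hi)
  ; zerosRight = λ i j lo hi → zeroAbove (j - i)
      (≤-diagonalˡ i _ (subst (ℤ._≤ j) (ℤₚ.+-assoc i (+ n) (+ 1)) lo))
      (≤-diagonalʳ i _ (subst (j ℤ.≤_) (reassoc i (+ n) (+ k)) hi))
  ; oneLeft    = λ i → trans (cong f (cancelˡ i (ℤ.- + 1))) fOneBelow
  ; oneRight   = λ i → trans (cong f (cancelˡ i (+ n))) fOneAbove
  ; detOne     = λ i j lo hi → trans (det-block-toeplitz k f i j)
      (detMinors (j - i) (≤-diagonalˡ i _ lo) (≤-diagonalʳ i _ hi))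
  }
  where
  reassoc : ∀ i n k → i ℤ.+ n ℤ.+ k - + 1 ≡ i ℤ.+ (n ℤ.+ k - + 1)
  reassoc = solve-∀
  cancelˡ : ∀ i x → (i ℤ.+ x) - i ≡ x
  cancelˡ = solve-∀

toeplitz-isPeriodic : ∀ n f → IsPeriodic n (toeplitz f)
toeplitz-isPeriodic n f = 1 , ℕ.s≤s ℕ.z≤n , λ i j _ _ →
  trans (entry-toeplitz f i j) (sym (entry-toeplitz f (i ℤ.+ + 1) j))

toeplitz-entriesPositiveIntegers : ∀ n f →
  (∀ j → + 1 ℤ.≤ j → j ℤ.≤ + n → Σ ℕ λ p → (0 ℕ.< p) × (f (j - + 1) ≡ (+ p) / 1)) →
  EntriesPositiveIntegers n (toeplitz f)
toeplitz-entriesPositiveIntegers n f positive i j lo hi with positive j lo hi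
... | p , 0<p , fj≡p = p , 0<p , trans (entry-toeplitz f i j) fj≡p

toeplitz-isWild : ∀ k n f →
  + 0 ℤ.≤ + 0 ℤ.+ + n - + 1 → det (ℕ.suc k) (toeplitzMatrix (ℕ.suc k) f (+ 0)) ≢ 0ℚ →
  IsWild k n (toeplitz f)
toeplitz-isWild k n f 0≤n-1 det≢0 tame =
  det≢0 (trans (sym (det-block-toeplitz (ℕ.suc k) f (+ 0) (+ 0))) (tame (+ 0) (+ 0) (+≤+ ℕ.z≤n) 0≤n-1))

band : ℤ → ℚ
band -[1+ 0 ]                       = 1ℚ
band -[1+ ℕ.suc _ ]                 = 0ℚ
band (+ 0)                          = 1ℚ
band (+ 1)                          = 1ℚ
band (+ 2)                          = 1ℚ
band (+ ℕ.suc (ℕ.suc (ℕ.suc _)))   = 0ℚ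

band-below : ∀ d → d ℤ.≤ -[1+ 1 ] → band d ≡ 0ℚ
band-below -[1+ ℕ.suc _ ] _ = refl
band-below -[1+ 0 ]       (-≤- ())

band-above : ∀ d → + 3 ℤ.≤ d → band d ≡ 0ℚ
band-above (+ ℕ.suc (ℕ.suc (ℕ.suc _))) _ = refl
band-above (+ 0)                        (+≤+ ())
band-above (+ 1)                        (+≤+ (ℕ.s≤s ()))
band-above (+ 2)                        (+≤+ (ℕ.s≤s (ℕ.s≤s ())))

det-band₄ : ∀ d → -[1+ 0 ] ℤ.≤ d → d ℤ.≤ + 2 → det 4 (toeplitzMatrix 4 band d) ≡ 1ℚ
det-band₄ -[1+ 0 ]                     _           _ = refl
det-band₄ (+ 0)                        _           _ = refl
det-band₄ (+ 1)                        _           _ = refl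
det-band₄ (+ 2)                        _           _ = refl
det-band₄ -[1+ ℕ.suc _ ]               (-≤- ())    _
det-band₄ (+ ℕ.suc (ℕ.suc (ℕ.suc _))) _           (+≤+ (ℕ.s≤s (ℕ.s≤s ())))

det-band₅ : det 5 (toeplitzMatrix 5 band (+ 0)) ≡ 1ℚ
det-band₅ = refl

band-positive : ∀ j → + 1 ℤ.≤ j → j ℤ.≤ + 2 → Σ ℕ λ p → (0 ℕ.< p) × (band (j - + 1) ≡ (+ p) / 1)
band-positive (+ 1)                        _        _ = 1 , ℕ.s≤s ℕ.z≤n , refl
band-positive (+ 2)                        _        _ = 1 , ℕ.s≤s ℕ.z≤n , refl
band-positive (+ 0)                        (+≤+ ()) _
band-positive (+ ℕ.suc (ℕ.suc (ℕ.suc _))) _        (+≤+ (ℕ.s≤s (ℕ.s≤s ())))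

mainTheorem1 : Σ ℕ λ k → Σ ℕ λ n → (2 ≤ k) × (1 ≤ n) × Σ (ℤ → ℤ → ℚ) λ a → IsSLFrieze k n a × IsPeriodic n a × IsWild k n a × EntriesPositiveIntegers n a
mainTheorem1 = 4 , 2 , ℕ.s≤s (ℕ.s≤s ℕ.z≤n) , ℕ.s≤s ℕ.z≤n , toeplitz band
  , toeplitz-isSLFrieze 4 2 band (λ d _ → band-below d) (λ d lo _ → band-above d lo) refl refl det-band₄
  , toeplitz-isPeriodic 2 band
  , toeplitz-isWild 4 2 band (+≤+ ℕ.z≤n) (λ det≡0 → 1≢0 (trans (sym det-band₅) det≡0))
  , toeplitz-entriesPositiveIntegers 2 band band-positive
  where
  1≢0 : 1ℚ ≢ 0ℚ
  1≢0 ()
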